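{- The graph $F(8,13,8)$ on vertex set $\{1,\dots,8\}$ with edges $\{1,2\},\{2,4\},\{3,4\},\{3,5\},\{1,5\},\{1,3\},\{2,3\},\{5,6\},\{6,8\},\{7,8\},\{5,7\},\{6,7\},\{4,8\}$ is forbidden.
   Context: All graphs are finite and simple. A graph $G$ with vertex set $V$ is unit-distance if there exists an injective map $\varphi\colon V\to\mathbf{R}^2$ with $|\varphi(v)-\varphi(w)|=1$ for every pair of adjacent vertices $v,w$ (non-adjacent vertices may also be at distance 1). A graph is forbidden if it is not unit-distance. -}

module Defs where

open import Level using (0ℓ; suc)
open import Data.Nat using (ℕ)
open import Data.Fin using (Fin; zero; suc; #_)
open import Data.Product using (Σ; ∃; _×_; _,_)
open import Data.List using (List; []; _∷_)
open import Data.List.Membership.Propositional using (_∈_)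
open import Data.Sum using (_⊎_)
open import Relation.Nullary using (¬_)
open import Relation.Binary.PropositionalEquality using (_≡_; _≢_)
open import Algebra.Core using (Op₁; Op₂)
import Algebra.Structures as AS
open import Relation.Binary.Structures using (IsTotalOrder)

-- The real numbers, axiomatised as a complete ordered field
-- (the stdlib has no reals).  Any model is isomorphic to ℝ.

record RealNumbers : Set₁ where
  infixl 6 _+_ _-_
  infixl 7 _*_
  infix 4 _≤_
  field
    ℝ   : Set
    _+_ _*_ : Op₂ ℝ
    -_  : Op₁ ℝ
    0ℝ 1ℝ : ℝ
    _≤_ : ℝ → ℝ → Set
    isCommutativeRing : AS.IsCommutativeRing _≡_ _+_ _*_ -_ 0ℝ 1ℝ
    0≢1 : 0ℝ ≢ 1ℝ
    inverse : ∀ x → x ≢ 0ℝ → Σ ℝ λ y → x * y ≡ 1ℝ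
    isTotalOrder : IsTotalOrder _≡_ _≤_
    +-mono-≤ : ∀ {x y} z → x ≤ y → x + z ≤ y + z
    *-nonneg : ∀ {x y} → 0ℝ ≤ x → 0ℝ ≤ y → 0ℝ ≤ x * y
    lub : (P : ℝ → Set) → (Σ ℝ P) → (Σ ℝ λ b → ∀ x → P x → x ≤ b) →
          Σ ℝ λ s → (∀ x → P x → x ≤ s) ×
                    (∀ b → (∀ x → P x → x ≤ b) → s ≤ b)

  _-_ : Op₂ ℝ
  x - y = x + (- y)

Graph : ℕ → Set
Graph n = List (Fin n × Fin n)

module _ (R : RealNumbers) where
  open RealNumbers R

  Point : Set
  Point = ℝ × ℝ

  -- squared Euclidean distance; |p - q| = 1  iff  sqDist p q = 1
  sqDist : Point → Point → ℝ
  sqDist (x₁ , y₁) (x₂ , y₂) = (x₁ - x₂) * (x₁ - x₂) + (y₁ - y₂) * (y₁ - y₂)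

  UnitDistance : ∀ {n} → Graph n → Set
  UnitDistance {n} G =
    Σ (Fin n → Point) λ φ →
      (∀ v w → φ v ≡ φ w → v ≡ w) ×
      (∀ v w → (v , w) ∈ G → sqDist (φ v) (φ w) ≡ 1ℝ)

Forbidden : ∀ {n} → Graph n → Set₁
Forbidden G = (R : RealNumbers) → ¬ UnitDistance R G

-- F(8,13,8); paper vertex k is  # (k - 1)

F-8-13-8 : Graph 8
F-8-13-8 =
    (# 0 , # 1) ∷ (# 1 , # 3) ∷ (# 2 , # 3) ∷ (# 2 , # 4) ∷ (# 0 , # 4) ∷
    (# 0 , # 2) ∷ (# 1 , # 2) ∷ (# 4 , # 5) ∷ (# 5 , # 7) ∷ (# 6 , # 7) ∷
    (# 4 , # 6) ∷ (# 5 , # 6) ∷ (# 3 , # 7) ∷ []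

module Submission where

-- The geometric engine is the rhombus lemma: two distinct points x, y at a common
-- distance from two distinct points p, q are mirror images in the midpoint of p q,
-- that is x + y = p + q.  With the vertices of F(8,13,8) numbered 0..7 it gives
--   φ1 + φ4 = φ0 + φ2,   φ0 + φ3 = φ1 + φ2,   φ5 + φ6 = φ4 + φ7,
-- so φ2 is the midpoint of φ4 φ3 and φ4 φ5 φ7 φ6 is a rhombus.  Apollonius' theorem
-- and the parallelogram law then force |φ2 φ7| = 1, so 2 and 5 are common neighbours
-- of 4 and 7 as well; the rhombus lemma gives φ2 + φ5 = φ4 + φ7 = φ5 + φ6, hence
-- φ2 = φ6, contradicting injectivity.

open import Algebra.Bundles using (CommutativeRing)
open import Algebra.Solver.Ring.AlmostCommutativeRing
  using (fromCommutativeRing; _-Raw-AlmostCommutative⟶_)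
import Algebra.Solver.Ring
open import Data.Fin using (Fin; #_)
import Data.Fin.Properties as Fin
open import Data.Integer as ℤ using (ℤ; -[1+_])
import Data.Integer.Properties as ℤ
open import Data.List.Membership.Propositional using (_∈_)
import Data.List.Membership.DecPropositional as Membership
open import Data.Maybe using (Maybe; just; nothing)
open import Data.Nat as ℕ using (ℕ; zero; suc)
import Data.Nat.Properties as ℕ
open import Data.Product using (_×_; _,_; proj₁; proj₂)
open import Data.Product.Properties using (≡-dec)
open import Data.Sign as Sign using (Sign)
open import Data.Sum using (_⊎_; inj₁; inj₂)
open import Function using (_∘_)
open import Relation.Binary.Structures using (IsTotalOrder)
open import Relation.Nullary using (¬_; Dec; yes; no)
open import Relation.Nullary.Decidable using (True; toWitness; _⊎-dec_)
import Relation.Binary.PropositionalEquality as ≡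

-- The integers map into every commutative ring; along this homomorphism the
-- standard ring solver decides polynomial identities with integer coefficients in
-- an arbitrary commutative ring (with its own coefficients it cannot cancel 1 - 1).
module IntegerCoefficients {c ℓ} (CR : CommutativeRing c ℓ) where
  open CommutativeRing CR
  open import Algebra.Properties.Ring ring
    using (-0#≈0#; -‿involutive; -‿+-comm; -‿distribˡ-*; -‿distribʳ-*)
  open import Algebra.Properties.Semiring.Mult.TCOptimised semiring
    using (1+×; ×-homo-+; ×1-homo-*) renaming (_×_ to _×′_)
  open import Relation.Binary.Reasoning.Setoid setoid

  -- The image of an integer; 1 ↦ 1# and 2 ↦ 1# + 1# hold definitionally.
  ⟦_⟧ℤ : ℤ → Carrier
  ⟦ ℤ.+ n ⟧ℤ    = n ×′ 1#
  ⟦ -[1+ n ] ⟧ℤ = - (suc n ×′ 1#)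

  signed : Sign → Carrier → Carrier
  signed Sign.+ x = x
  signed Sign.- x = - x

  signed-cong : ∀ s {x y} → x ≈ y → signed s x ≈ signed s y
  signed-cong Sign.+ x≈y = x≈y
  signed-cong Sign.- x≈y = -‿cong x≈y

  signed-* : ∀ s t x y → signed (s Sign.* t) (x * y) ≈ signed s x * signed t y
  signed-* Sign.+ Sign.+ x y = refl
  signed-* Sign.+ Sign.- x y = -‿distribʳ-* x y
  signed-* Sign.- Sign.+ x y = -‿distribˡ-* x y
  signed-* Sign.- Sign.- x y = begin
    x * y          ≈⟨ -‿involutive (x * y) ⟨
    - - (x * y)    ≈⟨ -‿cong (-‿distribˡ-* x y) ⟩
    - (- x * y)    ≈⟨ -‿distribʳ-* (- x) y ⟩
    - x * - y      ∎

  ⟦◃⟧ : ∀ s n → ⟦ s ℤ.◃ n ⟧ℤ ≈ signed s (n ×′ 1#)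
  ⟦◃⟧ Sign.+ zero    = refl
  ⟦◃⟧ Sign.- zero    = sym -0#≈0#
  ⟦◃⟧ Sign.+ (suc n) = refl
  ⟦◃⟧ Sign.- (suc n) = refl

  ⟦sign◃abs⟧ : ∀ i → ⟦ i ⟧ℤ ≈ signed (ℤ.sign i) (ℤ.∣ i ∣ ×′ 1#)
  ⟦sign◃abs⟧ (ℤ.+ n)  = refl
  ⟦sign◃abs⟧ -[1+ n ] = refl

  1+-difference : ∀ a b → a - b ≈ (1# + a) - (1# + b)
  1+-difference a b = begin
    a - b                     ≈⟨ +-identityˡ (a - b) ⟨
    0# + (a - b)              ≈⟨ +-congʳ (-‿inverseʳ 1#) ⟨
    (1# - 1#) + (a - b)       ≈⟨ +-assoc 1# (- 1#) (a - b) ⟩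
    1# + (- 1# + (a - b))     ≈⟨ +-congˡ (+-assoc (- 1#) a (- b)) ⟨
    1# + ((- 1# + a) - b)     ≈⟨ +-congˡ (+-congʳ (+-comm (- 1#) a)) ⟩
    1# + ((a - 1#) - b)       ≈⟨ +-congˡ (+-assoc a (- 1#) (- b)) ⟩
    1# + (a + (- 1# - b))     ≈⟨ +-assoc 1# a (- 1# - b) ⟨
    (1# + a) + (- 1# - b)     ≈⟨ +-congˡ (-‿+-comm 1# b) ⟩
    (1# + a) - (1# + b)       ∎

  ⟦⊖⟧ : ∀ m n → ⟦ m ℤ.⊖ n ⟧ℤ ≈ m ×′ 1# - n ×′ 1#
  ⟦⊖⟧ zero    zero    = sym (-‿inverseʳ 0#)
  ⟦⊖⟧ (suc m) zero    = sym (trans (+-congˡ -0#≈0#) (+-identityʳ _))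
  ⟦⊖⟧ zero    (suc n) = sym (+-identityˡ _)
  ⟦⊖⟧ (suc m) (suc n) = begin
    ⟦ suc m ℤ.⊖ suc n ⟧ℤ                ≡⟨ ≡.cong ⟦_⟧ℤ (ℤ.[1+m]⊖[1+n]≡m⊖n m n) ⟩
    ⟦ m ℤ.⊖ n ⟧ℤ                        ≈⟨ ⟦⊖⟧ m n ⟩
    m ×′ 1# - n ×′ 1#                   ≈⟨ 1+-difference (m ×′ 1#) (n ×′ 1#) ⟩
    (1# + m ×′ 1#) - (1# + n ×′ 1#)     ≈⟨ +-cong (1+× m 1#) (-‿cong (1+× n 1#)) ⟨
    suc m ×′ 1# - suc n ×′ 1#           ∎

  ⟦+⟧ : ∀ i j → ⟦ i ℤ.+ j ⟧ℤ ≈ ⟦ i ⟧ℤ + ⟦ j ⟧ℤ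
  ⟦+⟧ (ℤ.+ m)  (ℤ.+ n)  = ×-homo-+ 1# m n
  ⟦+⟧ (ℤ.+ m)  -[1+ n ] = ⟦⊖⟧ m (suc n)
  ⟦+⟧ -[1+ m ] (ℤ.+ n)  = trans (⟦⊖⟧ n (suc m)) (+-comm _ _)
  ⟦+⟧ -[1+ m ] -[1+ n ] = begin
    - (suc (suc (m ℕ.+ n)) ×′ 1#)     ≡⟨ ≡.cong (λ k → - (suc k ×′ 1#)) (ℕ.+-suc m n) ⟨
    - ((suc m ℕ.+ suc n) ×′ 1#)       ≈⟨ -‿cong (×-homo-+ 1# (suc m) (suc n)) ⟩
    - (suc m ×′ 1# + suc n ×′ 1#)     ≈⟨ -‿+-comm _ _ ⟨
    - (suc m ×′ 1#) - suc n ×′ 1#     ∎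

  ⟦*⟧ : ∀ i j → ⟦ i ℤ.* j ⟧ℤ ≈ ⟦ i ⟧ℤ * ⟦ j ⟧ℤ
  ⟦*⟧ i j = begin
    ⟦ s ℤ.◃ ∣i∣ ℕ.* ∣j∣ ⟧ℤ                                  ≈⟨ ⟦◃⟧ s (∣i∣ ℕ.* ∣j∣) ⟩
    signed s ((∣i∣ ℕ.* ∣j∣) ×′ 1#)                          ≈⟨ signed-cong s (×1-homo-* ∣i∣ ∣j∣) ⟩
    signed s ((∣i∣ ×′ 1#) * (∣j∣ ×′ 1#))                    ≈⟨ signed-* (ℤ.sign i) (ℤ.sign j) _ _ ⟩
    signed (ℤ.sign i) (∣i∣ ×′ 1#) * signed (ℤ.sign j) (∣j∣ ×′ 1#)
                                                            ≈⟨ *-cong (⟦sign◃abs⟧ i) (⟦sign◃abs⟧ j) ⟨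
    ⟦ i ⟧ℤ * ⟦ j ⟧ℤ                                         ∎
    where
    s = ℤ.sign i Sign.* ℤ.sign j
    ∣i∣ = ℤ.∣ i ∣
    ∣j∣ = ℤ.∣ j ∣

  ⟦-⟧ : ∀ i → ⟦ ℤ.- i ⟧ℤ ≈ - ⟦ i ⟧ℤ
  ⟦-⟧ (ℤ.+ zero)  = sym -0#≈0#
  ⟦-⟧ (ℤ.+ suc n) = refl
  ⟦-⟧ -[1+ n ]    = sym (-‿involutive _)

  homomorphism : ℤ.+-*-rawRing -Raw-AlmostCommutative⟶ fromCommutativeRing CR
  homomorphism = record
    { ⟦_⟧    = ⟦_⟧ℤ
    ; +-homo = ⟦+⟧
    ; *-homo = ⟦*⟧
    ; -‿homo = ⟦-⟧
    ; 0-homo = refl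
    ; 1-homo = refl
    }

  -- The solver only needs to recognise syntactically equal coefficients.
  coefficientsEqual? : ∀ i j → Maybe (⟦ i ⟧ℤ ≈ ⟦ j ⟧ℤ)
  coefficientsEqual? i j with i ℤ.≟ j
  ... | yes ≡.refl = just refl
  ... | no _       = nothing

  open Algebra.Solver.Ring ℤ.+-*-rawRing (fromCommutativeRing CR) homomorphism coefficientsEqual?
    public

open import Defs
open ≡ using (_≡_; _≢_; sym; trans; cong; cong₂; subst; subst₂; module ≡-Reasoning)

-- Vector operations on pairs over any carrier with addition, multiplication
-- and negation; instantiated both for points and for polynomial expressions.
module PlaneOperations {A : Set} (_+_ _*_ : A → A → A) (-_ : A → A) where
  infixl 6 _⊕_ _⊖_

  _⊕_ : A × A → A × A → A × A
  (x₁ , x₂) ⊕ (y₁ , y₂) = (x₁ + y₁) , (x₂ + y₂)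

  _⊖_ : A × A → A × A → A × A
  (x₁ , x₂) ⊖ (y₁ , y₂) = (x₁ + (- y₁)) , (x₂ + (- y₂))

  _·_ : A × A → A × A → A
  (x₁ , x₂) · (y₁ , y₂) = (x₁ * y₁) + (x₂ * y₂)

  _∧_ : A × A → A × A → A
  (x₁ , x₂) ∧ (y₁ , y₂) = (x₁ * y₂) + (- (x₂ * y₁))

  ‖_‖² : A × A → A
  ‖ x ‖² = x · x

-- Plane geometry over the axiomatised reals.
module Plane (R : RealNumbers) where
  open RealNumbers R
  private module Order = IsTotalOrder isTotalOrder

  commutativeRing : CommutativeRing _ _
  commutativeRing = record { isCommutativeRing = isCommutativeRing }

  open CommutativeRing commutativeRing
    using (+-comm; +-identityˡ; *-identityˡ; zeroʳ; -‿inverseʳ; ring)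
  open import Algebra.Properties.Ring ring using (+-cancelˡ; +-cancelʳ; x∙y⁻¹≈ε⇒x≈y; x≈y⇒x∙y⁻¹≈ε)
  open IntegerCoefficients commutativeRing using (Polynomial; solve; _:=_; _:+_; _:*_; _:-_; :-_; con)
  open ≡-Reasoning

  lit : ∀ {n} → ℕ → Polynomial n
  lit k = con (ℤ.+ k)

  -- Vector operations on points, and their syntactic counterparts for the solver;
  -- the two agree definitionally under evaluation, and sqDist R p q is ‖ p ⊖ q ‖².
  open PlaneOperations _+_ _*_ -_ public
  private
    module Syntax {n : ℕ} = PlaneOperations {Polynomial n} _:+_ _:*_ :-_
  open Syntax using () renaming (_⊕_ to _⊕ₚ_; _⊖_ to _⊖ₚ_; _·_ to _·ₚ_; _∧_ to _∧ₚ_; ‖_‖² to ‖_‖²ₚ)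

  -- The constant 2, which the solver writes lit 2.
  two : ℝ
  two = 1ℝ + 1ℝ

  cancel : ∀ {c z} → c ≢ 0ℝ → c * z ≡ 0ℝ → z ≡ 0ℝ
  cancel {c} {z} c≢0 cz≡0 with inverse c c≢0
  ... | c⁻¹ , cc⁻¹≡1 = begin
    z                ≡⟨ *-identityˡ z ⟨
    1ℝ * z           ≡⟨ cong (_* z) cc⁻¹≡1 ⟨
    (c * c⁻¹) * z    ≡⟨ solve 3 (λ c c⁻¹ z → (c :* c⁻¹) :* z := c⁻¹ :* (c :* z)) ≡.refl c c⁻¹ z ⟩
    c⁻¹ * (c * z)    ≡⟨ cong (c⁻¹ *_) cz≡0 ⟩
    c⁻¹ * 0ℝ         ≡⟨ zeroʳ c⁻¹ ⟩
    0ℝ               ∎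

  square-nonneg : ∀ x → 0ℝ ≤ x * x
  square-nonneg x with Order.total 0ℝ x
  ... | inj₁ 0≤x = *-nonneg 0≤x 0≤x
  ... | inj₂ x≤0 = subst (0ℝ ≤_) (solve 1 (λ x → :- x :* :- x := x :* x) ≡.refl x) (*-nonneg 0≤-x 0≤-x)
    where
    0≤-x : 0ℝ ≤ - x
    0≤-x = subst₂ _≤_ (-‿inverseʳ x) (+-identityˡ (- x)) (+-mono-≤ (- x) x≤0)

  sumOfSquares-zeroˡ : ∀ x y → x * x + y * y ≡ 0ℝ → x * x ≡ 0ℝ
  sumOfSquares-zeroˡ x y sum≡0 = Order.antisym x²≤0 (square-nonneg x)
    where
    x²≤0 : x * x ≤ 0ℝ
    x²≤0 = subst₂ _≤_ (+-identityˡ (x * x)) (trans (+-comm (y * y) (x * x)) sum≡0)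
                   (+-mono-≤ (x * x) (square-nonneg y))

  two≢0 : two ≢ 0ℝ
  two≢0 two≡0 = 0≢1 (Order.antisym 0≤1 1≤0)
    where
    0≤1 : 0ℝ ≤ 1ℝ
    0≤1 = subst (0ℝ ≤_) (*-identityˡ 1ℝ) (square-nonneg 1ℝ)
    1≤0 : 1ℝ ≤ 0ℝ
    1≤0 = subst₂ _≤_ (+-identityˡ 1ℝ) two≡0 (+-mono-≤ 1ℝ 0≤1)

  double-injective : ∀ {x y} → two * x ≡ two * y → x ≡ y
  double-injective {x} {y} 2x≡2y = x∙y⁻¹≈ε⇒x≈y x y (cancel two≢0 (begin
    two * (x - y)        ≡⟨ solve 2 (λ x y → lit 2 :* (x :- y) := lit 2 :* x :- lit 2 :* y) ≡.refl x y ⟩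
    two * x - two * y    ≡⟨ x≈y⇒x∙y⁻¹≈ε 2x≡2y ⟩
    0ℝ                   ∎))

  -- A square vanishes only at zero, up to double negation (R has no decidable equality).
  square-zero : ∀ {x} → x * x ≡ 0ℝ → ¬ ¬ (x ≡ 0ℝ)
  square-zero x²≡0 x≢0 = x≢0 (cancel x≢0 x²≡0)

  origin : Point R
  origin = 0ℝ , 0ℝ

  ‖‖²-nonzero : ∀ {e} → e ≢ origin → ‖ e ‖² ≢ 0ℝ
  ‖‖²-nonzero {e₁ , e₂} e≢0 N≡0 =
    square-zero (sumOfSquares-zeroˡ e₁ e₂ N≡0) λ e₁≡0 →
    square-zero (sumOfSquares-zeroˡ e₂ e₁ (trans (+-comm _ _) N≡0)) λ e₂≡0 →
    e≢0 (cong₂ _,_ e₁≡0 e₂≡0)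

  -- A vector both orthogonal and parallel to a nonzero vector e is zero,
  -- since ‖e‖² v = (v·e) e + (v∧e) e⊥.
  vanishes : ∀ {e} v → e ≢ origin → v · e ≡ 0ℝ → v ∧ e ≡ 0ℝ → v ≡ origin
  vanishes {e@(e₁ , e₂)} v@(v₁ , v₂) e≢0 v·e≡0 v∧e≡0 =
    cong₂ _,_ (cancel N≢0 Nv₁≡0) (cancel N≢0 Nv₂≡0)
    where
    N≢0 : ‖ e ‖² ≢ 0ℝ
    N≢0 = ‖‖²-nonzero e≢0
    Nv₁≡0 : ‖ e ‖² * v₁ ≡ 0ℝ
    Nv₁≡0 = begin
      ‖ e ‖² * v₁                      ≡⟨ solve 4 (λ v₁ v₂ e₁ e₂ → let v = v₁ , v₂; e = e₁ , e₂ in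
                                            ‖ e ‖²ₚ :* v₁ := (v ·ₚ e) :* e₁ :+ (v ∧ₚ e) :* e₂)
                                            ≡.refl v₁ v₂ e₁ e₂ ⟩
      (v · e) * e₁ + (v ∧ e) * e₂      ≡⟨ cong₂ (λ a b → a * e₁ + b * e₂) v·e≡0 v∧e≡0 ⟩
      0ℝ * e₁ + 0ℝ * e₂                ≡⟨ solve 2 (λ e₁ e₂ → lit 0 :* e₁ :+ lit 0 :* e₂ := lit 0) ≡.refl e₁ e₂ ⟩
      0ℝ                               ∎
    Nv₂≡0 : ‖ e ‖² * v₂ ≡ 0ℝ
    Nv₂≡0 = begin
      ‖ e ‖² * v₂                      ≡⟨ solve 4 (λ v₁ v₂ e₁ e₂ → let v = v₁ , v₂; e = e₁ , e₂ in
                                            ‖ e ‖²ₚ :* v₂ := (v ·ₚ e) :* e₂ :- (v ∧ₚ e) :* e₁)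
                                            ≡.refl v₁ v₂ e₁ e₂ ⟩
      (v · e) * e₂ - (v ∧ e) * e₁      ≡⟨ cong₂ (λ a b → a * e₂ - b * e₁) v·e≡0 v∧e≡0 ⟩
      0ℝ * e₂ - 0ℝ * e₁                ≡⟨ solve 2 (λ e₁ e₂ → lit 0 :* e₂ :- lit 0 :* e₁ := lit 0) ≡.refl e₁ e₂ ⟩
      0ℝ                               ∎

  onBisector : ∀ u e → ‖ u ‖² ≡ ‖ u ⊖ e ‖² → two * (u · e) ≡ ‖ e ‖²
  onBisector u@(u₁ , u₂) e@(e₁ , e₂) equidistant = +-cancelˡ ‖ u ⊖ e ‖² _ _ (begin
    ‖ u ⊖ e ‖² + two * (u · e)    ≡⟨ solve 4 (λ u₁ u₂ e₁ e₂ → let u = u₁ , u₂; e = e₁ , e₂ in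
                                        ‖ u ⊖ₚ e ‖²ₚ :+ lit 2 :* (u ·ₚ e) := ‖ u ‖²ₚ :+ ‖ e ‖²ₚ)
                                        ≡.refl u₁ u₂ e₁ e₂ ⟩
    ‖ u ‖² + ‖ e ‖²               ≡⟨ cong (_+ ‖ e ‖²) equidistant ⟩
    ‖ u ⊖ e ‖² + ‖ e ‖²           ∎)

  lagrange : ∀ u e → ‖ e ‖² * ‖ u ‖² ≡ (u · e) * (u · e) + (u ∧ e) * (u ∧ e)
  lagrange (u₁ , u₂) (e₁ , e₂) = solve 4 (λ u₁ u₂ e₁ e₂ → let u = u₁ , u₂; e = e₁ , e₂ in
    ‖ e ‖²ₚ :* ‖ u ‖²ₚ := (u ·ₚ e) :* (u ·ₚ e) :+ (u ∧ₚ e) :* (u ∧ₚ e)) ≡.refl u₁ u₂ e₁ e₂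

  ·-⊖ : ∀ u w e → (u ⊖ w) · e ≡ u · e - w · e
  ·-⊖ (u₁ , u₂) (w₁ , w₂) (e₁ , e₂) = solve 6 (λ u₁ u₂ w₁ w₂ e₁ e₂ →
    let u = u₁ , u₂; w = w₁ , w₂; e = e₁ , e₂ in
    (u ⊖ₚ w) ·ₚ e := u ·ₚ e :- w ·ₚ e) ≡.refl u₁ u₂ w₁ w₂ e₁ e₂

  ∧-⊖ : ∀ u w e → (u ⊖ w) ∧ e ≡ u ∧ e - w ∧ e
  ∧-⊖ (u₁ , u₂) (w₁ , w₂) (e₁ , e₂) = solve 6 (λ u₁ u₂ w₁ w₂ e₁ e₂ →
    let u = u₁ , u₂; w = w₁ , w₂; e = e₁ , e₂ in
    (u ⊖ₚ w) ∧ₚ e := u ∧ₚ e :- w ∧ₚ e) ≡.refl u₁ u₂ w₁ w₂ e₁ e₂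

  ·-⊕⊖ : ∀ u w e → (u ⊕ w ⊖ e) · e ≡ u · e + w · e - ‖ e ‖²
  ·-⊕⊖ (u₁ , u₂) (w₁ , w₂) (e₁ , e₂) = solve 6 (λ u₁ u₂ w₁ w₂ e₁ e₂ →
    let u = u₁ , u₂; w = w₁ , w₂; e = e₁ , e₂ in
    (u ⊕ₚ w ⊖ₚ e) ·ₚ e := u ·ₚ e :+ w ·ₚ e :- ‖ e ‖²ₚ) ≡.refl u₁ u₂ w₁ w₂ e₁ e₂

  ∧-⊕⊖ : ∀ u w e → (u ⊕ w ⊖ e) ∧ e ≡ u ∧ e + w ∧ e
  ∧-⊕⊖ (u₁ , u₂) (w₁ , w₂) (e₁ , e₂) = solve 6 (λ u₁ u₂ w₁ w₂ e₁ e₂ →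
    let u = u₁ , u₂; w = w₁ , w₂; e = e₁ , e₂ in
    (u ⊕ₚ w ⊖ₚ e) ∧ₚ e := u ∧ₚ e :+ w ∧ₚ e) ≡.refl u₁ u₂ w₁ w₂ e₁ e₂

  ⊖-zero : ∀ {u w} → u ⊖ w ≡ origin → u ≡ w
  ⊖-zero {u₁ , u₂} {w₁ , w₂} u-w≡0 =
    cong₂ _,_ (x∙y⁻¹≈ε⇒x≈y u₁ w₁ (cong proj₁ u-w≡0)) (x∙y⁻¹≈ε⇒x≈y u₂ w₂ (cong proj₂ u-w≡0))

  rhombusAtOrigin : ∀ {d} u w e → e ≢ origin → u ≢ w →
    ‖ u ‖² ≡ d → ‖ u ⊖ e ‖² ≡ d → ‖ w ‖² ≡ d → ‖ w ⊖ e ‖² ≡ d → u ⊕ w ≡ e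
  rhombusAtOrigin u w e e≢0 u≢w ‖u‖ ‖u-e‖ ‖w‖ ‖w-e‖ =
    ⊖-zero (vanishes (u ⊕ w ⊖ e) e≢0 dot≡0 (trans (∧-⊕⊖ u w e) det+det≡0))
    where
    2u·e≡N : two * (u · e) ≡ ‖ e ‖²
    2u·e≡N = onBisector u e (trans ‖u‖ (sym ‖u-e‖))
    2w·e≡N : two * (w · e) ≡ ‖ e ‖²
    2w·e≡N = onBisector w e (trans ‖w‖ (sym ‖w-e‖))
    u·e≡w·e : u · e ≡ w · e
    u·e≡w·e = double-injective (trans 2u·e≡N (sym 2w·e≡N))
    det²≡det² : (u ∧ e) * (u ∧ e) ≡ (w ∧ e) * (w ∧ e)
    det²≡det² = +-cancelˡ ((u · e) * (u · e)) _ _ (begin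
      (u · e) * (u · e) + (u ∧ e) * (u ∧ e)    ≡⟨ lagrange u e ⟨
      ‖ e ‖² * ‖ u ‖²                          ≡⟨ cong (‖ e ‖² *_) (trans ‖u‖ (sym ‖w‖)) ⟩
      ‖ e ‖² * ‖ w ‖²                          ≡⟨ lagrange w e ⟩
      (w · e) * (w · e) + (w ∧ e) * (w ∧ e)    ≡⟨ cong (λ a → a * a + (w ∧ e) * (w ∧ e)) u·e≡w·e ⟨
      (u · e) * (u · e) + (w ∧ e) * (w ∧ e)    ∎)
    -- the determinants differ, for otherwise u ⊖ w would vanish
    det≢det : u ∧ e - w ∧ e ≢ 0ℝ
    det≢det difference≡0 = u≢w (⊖-zero (vanishes (u ⊖ w) e≢0
      (trans (·-⊖ u w e) (x≈y⇒x∙y⁻¹≈ε u·e≡w·e)) (trans (∧-⊖ u w e) difference≡0)))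
    det+det≡0 : u ∧ e + w ∧ e ≡ 0ℝ
    det+det≡0 = cancel det≢det (begin
      (u ∧ e - w ∧ e) * (u ∧ e + w ∧ e)        ≡⟨ solve 2 (λ t r → (t :- r) :* (t :+ r) := t :* t :- r :* r)
                                                           ≡.refl (u ∧ e) (w ∧ e) ⟩
      (u ∧ e) * (u ∧ e) - (w ∧ e) * (w ∧ e)    ≡⟨ x≈y⇒x∙y⁻¹≈ε det²≡det² ⟩
      0ℝ                                       ∎)
    dot≡0 : (u ⊕ w ⊖ e) · e ≡ 0ℝ
    dot≡0 = begin
      (u ⊕ w ⊖ e) · e               ≡⟨ ·-⊕⊖ u w e ⟩
      u · e + w · e - ‖ e ‖²        ≡⟨ cong (λ a → a + w · e - ‖ e ‖²) u·e≡w·e ⟩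
      w · e + w · e - ‖ e ‖²        ≡⟨ cong (_- ‖ e ‖²) (solve 1 (λ a → a :+ a := lit 2 :* a) ≡.refl (w · e)) ⟩
      two * (w · e) - ‖ e ‖²        ≡⟨ x≈y⇒x∙y⁻¹≈ε 2w·e≡N ⟩
      0ℝ                            ∎

  sqDist-sym : ∀ p q → sqDist R p q ≡ sqDist R q p
  sqDist-sym (p₁ , p₂) (q₁ , q₂) = solve 4 (λ p₁ p₂ q₁ q₂ →
    ‖ (p₁ , p₂) ⊖ₚ (q₁ , q₂) ‖²ₚ := ‖ (q₁ , q₂) ⊖ₚ (p₁ , p₂) ‖²ₚ) ≡.refl p₁ p₂ q₁ q₂

  translate : ∀ x p q → (x ⊖ p) ⊖ (q ⊖ p) ≡ x ⊖ q
  translate (x₁ , x₂) (p₁ , p₂) (q₁ , q₂) = cong₂ _,_ (coordinate x₁ p₁ q₁) (coordinate x₂ p₂ q₂)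
    where
    coordinate : ∀ x p q → (x - p) - (q - p) ≡ x - q
    coordinate = solve 3 (λ x p q → (x :- p) :- (q :- p) := x :- q) ≡.refl

  ⊖-cancelʳ : ∀ {x y p} → x ⊖ p ≡ y ⊖ p → x ≡ y
  ⊖-cancelʳ {x₁ , x₂} {y₁ , y₂} {p₁ , p₂} x-p≡y-p =
    cong₂ _,_ (+-cancelʳ (- p₁) x₁ y₁ (cong proj₁ x-p≡y-p)) (+-cancelʳ (- p₂) x₂ y₂ (cong proj₂ x-p≡y-p))

  untranslate : ∀ {x y p q} → (x ⊖ p) ⊕ (y ⊖ p) ≡ q ⊖ p → x ⊕ y ≡ p ⊕ q
  untranslate {x₁ , x₂} {y₁ , y₂} {p₁ , p₂} {q₁ , q₂} h =
    cong₂ _,_ (coordinate x₁ y₁ p₁ q₁ (cong proj₁ h)) (coordinate x₂ y₂ p₂ q₂ (cong proj₂ h))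
    where
    coordinate : ∀ x y p q → (x - p) + (y - p) ≡ q - p → x + y ≡ p + q
    coordinate x y p q h = begin
      x + y                          ≡⟨ solve 3 (λ x y p → x :+ y := ((x :- p) :+ (y :- p)) :+ (p :+ p)) ≡.refl x y p ⟩
      ((x - p) + (y - p)) + (p + p)  ≡⟨ cong (_+ (p + p)) h ⟩
      (q - p) + (p + p)              ≡⟨ solve 2 (λ p q → (q :- p) :+ (p :+ p) := p :+ q) ≡.refl p q ⟩
      p + q                          ∎

  rhombus : ∀ {d p q x y} → p ≢ q → x ≢ y →
    sqDist R x p ≡ d → sqDist R x q ≡ d → sqDist R y p ≡ d → sqDist R y q ≡ d → x ⊕ y ≡ p ⊕ q
  rhombus {p = p} {q} {x} {y} p≢q x≢y xp xq yp yq = untranslate (rhombusAtOrigin (x ⊖ p) (y ⊖ p) (q ⊖ p)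
    (λ q-p≡0 → p≢q (sym (⊖-zero q-p≡0))) (λ x-p≡y-p → x≢y (⊖-cancelʳ x-p≡y-p))
    xp (trans (cong ‖_‖² (translate x p q)) xq) yp (trans (cong ‖_‖² (translate y p q)) yq))

  solveFor : ∀ {x b s} → s ≡ b ⊕ x → x ≡ s ⊖ b
  solveFor {x₁ , x₂} {b₁ , b₂} {s₁ , s₂} s≡b+x =
    cong₂ _,_ (coordinate x₁ b₁ s₁ (cong proj₁ s≡b+x)) (coordinate x₂ b₂ s₂ (cong proj₂ s≡b+x))
    where
    coordinate : ∀ x b s → s ≡ b + x → x ≡ s - b
    coordinate x b s s≡b+x = begin
      x              ≡⟨ solve 2 (λ x b → x := (b :+ x) :- b) ≡.refl x b ⟩
      (b + x) - b    ≡⟨ cong (_- b) s≡b+x ⟨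
      s - b          ∎

  -- Apollonius' theorem for the median m a of the triangle m b a′, where a is the
  -- midpoint of b a′ (doubled, to avoid fractions).
  apollonius : ∀ a b a′ m → a ⊕ a ≡ b ⊕ a′ →
    two * sqDist R a m + two * sqDist R a b ≡ sqDist R b m + sqDist R a′ m
  apollonius a b a′ m midpoint rewrite solveFor {a′} {b} midpoint = identity a b m
    where
    identity : ∀ a b m → two * sqDist R a m + two * sqDist R a b ≡ sqDist R b m + sqDist R (a ⊕ a ⊖ b) m
    identity (a₁ , a₂) (b₁ , b₂) (m₁ , m₂) = solve 6 (λ a₁ a₂ b₁ b₂ m₁ m₂ →
      let a = a₁ , a₂; b = b₁ , b₂; m = m₁ , m₂ in
      lit 2 :* ‖ a ⊖ₚ m ‖²ₚ :+ lit 2 :* ‖ a ⊖ₚ b ‖²ₚ := ‖ b ⊖ₚ m ‖²ₚ :+ ‖ a ⊕ₚ a ⊖ₚ b ⊖ₚ m ‖²ₚ)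
      ≡.refl a₁ a₂ b₁ b₂ m₁ m₂

  parallelogram : ∀ b c d m → c ⊕ d ≡ b ⊕ m →
    sqDist R b m + sqDist R c d ≡ two * sqDist R b c + two * sqDist R b d
  parallelogram b c d m diagonals rewrite solveFor {m} {b} diagonals = identity b c d
    where
    identity : ∀ b c d → sqDist R b (c ⊕ d ⊖ b) + sqDist R c d ≡ two * sqDist R b c + two * sqDist R b d
    identity (b₁ , b₂) (c₁ , c₂) (d₁ , d₂) = solve 6 (λ b₁ b₂ c₁ c₂ d₁ d₂ →
      let b = b₁ , b₂; c = c₁ , c₂; d = d₁ , d₂ in
      ‖ b ⊖ₚ (c ⊕ₚ d ⊖ₚ b) ‖²ₚ :+ ‖ c ⊖ₚ d ‖²ₚ := lit 2 :* ‖ b ⊖ₚ c ‖²ₚ :+ lit 2 :* ‖ b ⊖ₚ d ‖²ₚ)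
      ≡.refl b₁ b₂ c₁ c₂ d₁ d₂

  medianLemma : ∀ {a b c d a′ m} → a ⊕ a ≡ b ⊕ a′ → c ⊕ d ≡ b ⊕ m →
    sqDist R a b ≡ 1ℝ → sqDist R b c ≡ 1ℝ → sqDist R b d ≡ 1ℝ → sqDist R c d ≡ 1ℝ →
    sqDist R a′ m ≡ 1ℝ → sqDist R a m ≡ 1ℝ
  medianLemma {a} {b} {c} {d} {a′} {m} midpoint diagonals ab bc bd cd a′m =
    double-injective (+-cancelʳ (two * 1ℝ) _ _ (begin
      two * sqDist R a m + two * 1ℝ            ≡⟨ cong (λ s → two * sqDist R a m + two * s) ab ⟨
      two * sqDist R a m + two * sqDist R a b  ≡⟨ apollonius a b a′ m midpoint ⟩
      sqDist R b m + sqDist R a′ m             ≡⟨ cong (sqDist R b m +_) (trans a′m (sym cd)) ⟩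
      sqDist R b m + sqDist R c d              ≡⟨ parallelogram b c d m diagonals ⟩
      two * sqDist R b c + two * sqDist R b d  ≡⟨ cong₂ (λ s t → two * s + two * t) bc bd ⟩
      two * 1ℝ + two * 1ℝ                      ∎))

  ⊕-exchange : ∀ {a b c d e} → b ⊕ e ≡ a ⊕ c → a ⊕ d ≡ b ⊕ c → c ⊕ c ≡ e ⊕ d
  ⊕-exchange {a₁ , a₂} {b₁ , b₂} {c₁ , c₂} {d₁ , d₂} {e₁ , e₂} h₁ h₂ =
    cong₂ _,_ (coordinate a₁ b₁ c₁ d₁ e₁ (cong proj₁ h₁) (cong proj₁ h₂))
              (coordinate a₂ b₂ c₂ d₂ e₂ (cong proj₂ h₁) (cong proj₂ h₂))
    where
    coordinate : ∀ a b c d e → b + e ≡ a + c → a + d ≡ b + c → c + c ≡ e + d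
    coordinate a b c d e h₁ h₂ = +-cancelʳ (a + b) _ _ (begin
      (c + c) + (a + b)     ≡⟨ solve 3 (λ a b c → (c :+ c) :+ (a :+ b) := (a :+ c) :+ (b :+ c)) ≡.refl a b c ⟩
      (a + c) + (b + c)     ≡⟨ cong₂ _+_ h₁ h₂ ⟨
      (b + e) + (a + d)     ≡⟨ solve 4 (λ a b d e → (b :+ e) :+ (a :+ d) := (e :+ d) :+ (a :+ b)) ≡.refl a b d e ⟩
      (e + d) + (a + b)     ∎)

  ⊕-cancel : ∀ {x y z} → x ⊕ z ≡ z ⊕ y → x ≡ y
  ⊕-cancel {x₁ , x₂} {y₁ , y₂} {z₁ , z₂} h =
    cong₂ _,_ (+-cancelʳ z₁ x₁ y₁ (trans (cong proj₁ h) (+-comm z₁ y₁)))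
              (+-cancelʳ z₂ x₂ y₂ (trans (cong proj₂ h) (+-comm z₂ y₂)))

-- The ends of an edge of a unit-distance realisation are at distance 1, whichever
-- way round the edge is listed; adjacency in a concrete graph is decided by evaluation.
module Realisation (R : RealNumbers) {n} (G : Graph n) (φ : Fin n → Point R)
  (unit : ∀ v w → (v , w) ∈ G → sqDist R (φ v) (φ w) ≡ RealNumbers.1ℝ R) where
  open Membership (≡-dec (Fin._≟_ {n}) (Fin._≟_ {n})) using (_∈?_)

  Adjacent : Fin n → Fin n → Set
  Adjacent v w = (v , w) ∈ G ⊎ (w , v) ∈ G

  adjacent? : ∀ v w → Dec (Adjacent v w)
  adjacent? v w = ((v , w) ∈? G) ⊎-dec ((w , v) ∈? G)

  edge : ∀ v w → {True (adjacent? v w)} → sqDist R (φ v) (φ w) ≡ RealNumbers.1ℝ R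
  edge v w {adjacent} with toWitness {a? = adjacent? v w} adjacent
  ... | inj₁ vw = unit v w vw
  ... | inj₂ wv = trans (Plane.sqDist-sym R (φ v) (φ w)) (unit w v wv)

mainTheorem5 : Forbidden F-8-13-8
mainTheorem5 R (φ , injective , unit) = apart (λ ()) φ₂≡φ₆
  where
  open RealNumbers R using (1ℝ)
  open Plane R
  open Realisation R F-8-13-8 φ unit

  apart : ∀ {v w} → v ≢ w → φ v ≢ φ w
  apart v≢w = v≢w ∘ injective _ _

  φ₁φ₄ : φ (# 1) ⊕ φ (# 4) ≡ φ (# 0) ⊕ φ (# 2)
  φ₁φ₄ = rhombus (apart λ ()) (apart λ ())
    (edge (# 1) (# 0)) (edge (# 1) (# 2)) (edge (# 4) (# 0)) (edge (# 4) (# 2))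

  φ₀φ₃ : φ (# 0) ⊕ φ (# 3) ≡ φ (# 1) ⊕ φ (# 2)
  φ₀φ₃ = rhombus (apart λ ()) (apart λ ())
    (edge (# 0) (# 1)) (edge (# 0) (# 2)) (edge (# 3) (# 1)) (edge (# 3) (# 2))

  φ₅φ₆ : φ (# 5) ⊕ φ (# 6) ≡ φ (# 4) ⊕ φ (# 7)
  φ₅φ₆ = rhombus (apart λ ()) (apart λ ())
    (edge (# 5) (# 4)) (edge (# 5) (# 7)) (edge (# 6) (# 4)) (edge (# 6) (# 7))

  -- φ₂ is the midpoint of φ₄ φ₃ and φ₄ φ₅ φ₇ φ₆ is a rhombus, so φ₂ is at distance 1 from φ₇ ...
  φ₂φ₇ : sqDist R (φ (# 2)) (φ (# 7)) ≡ 1ℝ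
  φ₂φ₇ = medianLemma (⊕-exchange φ₁φ₄ φ₀φ₃) φ₅φ₆
    (edge (# 2) (# 4)) (edge (# 4) (# 5)) (edge (# 4) (# 6)) (edge (# 5) (# 6)) (edge (# 3) (# 7))

  -- ... making 2 and 5 common neighbours of 4 and 7 as well
  φ₂φ₅ : φ (# 2) ⊕ φ (# 5) ≡ φ (# 4) ⊕ φ (# 7)
  φ₂φ₅ = rhombus (apart λ ()) (apart λ ())
    (edge (# 2) (# 4)) φ₂φ₇ (edge (# 5) (# 4)) (edge (# 5) (# 7))

  -- both φ₂ and φ₆ are the reflection of φ₅ in the midpoint of φ₄ φ₇
  φ₂≡φ₆ : φ (# 2) ≡ φ (# 6)
  φ₂≡φ₆ = ⊕-cancel (trans φ₂φ₅ (sym φ₅φ₆))
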